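{- Let $P\colon\mathcal{C}^{op}\to\mathbf{DLat}$ be a $\{\land,\lor,=\}$-doctrine with equality predicates $\delta_d\in P(d\times d)$, and let $P^\exists$ be its existential completion as described in the context. Then $P^\exists$ is a $\{\exists,\land,\lor,=\}$-doctrine, and its equality predicate at $d\in\mathcal{C}$ is $\{(1,\delta_d)\}\in P^\exists(d\times d)$.
   Context: A $\{\land,\lor\}$-doctrine is a functor $P\colon\mathcal{C}^{op}\to\mathbf{DLat}$ ($\mathcal{C}$ with finite products, $1$ terminal); $f^\ast=P(f)$; $\pi_d\colon d\times c\to c$ denotes the projection forgetting $d$. It is a $\{\land,\lor,=\}$-doctrine if for each $d$ there is $\delta_d\in P(d\times d)$ such that for every $d'$ the map $\pi_d^\ast(-)\land\pi_{d'}^\ast\delta_d\colon P(d'\times d)\to P(d'\times d\times d)$ (here $\pi_d\colon d'\times d\times d\to d'\times d$ forgets one copy of $d$, $\pi_{d'}\colon d'\times d\times d\to d\times d$ forgets $d'$) is left adjoint to $(1_{d'}\times\Delta_d)^\ast$, with $\Delta_d$ the diagonal. It is a $\{\exists,\land,\lor\}$-doctrine if each $\pi_d^\ast\colon P(c)\to P(d\times c)$ has a left adjoint $\Sigma_d$ satisfying Frobenius ($x\land\Sigma_d y=\Sigma_d(\pi_d^\ast x\land y)$) and Beck–Chevalley ($f^\ast\Sigma_d=\Sigma_d(1_d\times f)^\ast$); a $\{\exists,\land,\lor,=\}$-doctrine has both structures. $P^\exists(c)$ is the posetal reflection of the preorder of finite sets $\{(d_1,x_1),\dots,(d_n,x_n)\}$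 ($d_i\in\mathcal{C}$, $x_i\in P(d_i\times c)$) with $\{(d_i,x_i)\}_{i\le n}\le\{(e_j,y_j)\}_{j\le m}$ iff for each $i$ there are arrows $r_\ell\colon d_i\times c\to e_{j_\ell}\times c$ ($\ell=1,\dots,k$, $j_\ell\le m$) with $\pi_{e_{j_\ell}}\circ r_\ell=\pi_{d_i}$ and $x_i\le r_1^\ast y_{j_1}\lor\dots\lor r_k^\ast y_{j_k}$; $P^\exists(f)$ for $f\colon c'\to c$ sends $\{(d_i,x_i)\}$ to $\{(d_i,(1_{d_i}\times f)^\ast x_i)\}$; $\Sigma_d\colon P^\exists(d\times c)\to P^\exists(c)$ sends $\{(e_i,x_i)\}$ to $\{(e_i\times d,x_i)\}$. In $\{(1,\delta_d)\}$ one identifies $1\times(d\times d)\cong d\times d$. -}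

module Defs where

open import Level using (Level; _⊔_) renaming (suc to lsuc)
open import Data.Product using (Σ; _×_; _,_; proj₁; proj₂)
open import Data.List using (List; []; _∷_; map; foldr)
open import Data.List.Membership.Propositional using (_∈_)
open import Relation.Binary.PropositionalEquality using (_≡_)
open import Function.Bundles using (_⇔_)

record Cat (o h : Level) : Set (lsuc (o ⊔ h)) where
  infixr 9 _∘_
  infixr 7 _⊗_
  field
    Obj : Set o
    Hom : Obj → Obj → Set h
    id  : ∀ {a} → Hom a a
    _∘_ : ∀ {a b c} → Hom b c → Hom a b → Hom a c
    identityˡ : ∀ {a b} (f : Hom a b) → id ∘ f ≡ f
    identityʳ : ∀ {a b} (f : Hom a b) → f ∘ id ≡ f
    assoc : ∀ {a b c d} (f : Hom c d) (g : Hom b c) (k : Hom a b) →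
            (f ∘ g) ∘ k ≡ f ∘ (g ∘ k)
    𝟙 : Obj
    ! : ∀ {a} → Hom a 𝟙
    !-unique : ∀ {a} (f : Hom a 𝟙) → f ≡ !
    _⊗_ : Obj → Obj → Obj
    p₁ : ∀ {a b} → Hom (a ⊗ b) a
    p₂ : ∀ {a b} → Hom (a ⊗ b) b
    ⟨_,_⟩ : ∀ {a b c} → Hom c a → Hom c b → Hom c (a ⊗ b)
    β₁ : ∀ {a b c} (f : Hom c a) (g : Hom c b) → p₁ ∘ ⟨ f , g ⟩ ≡ f
    β₂ : ∀ {a b c} (f : Hom c a) (g : Hom c b) → p₂ ∘ ⟨ f , g ⟩ ≡ g
    ⟨⟩-unique : ∀ {a b c} (f : Hom c a) (g : Hom c b) (k : Hom c (a ⊗ b)) →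
                p₁ ∘ k ≡ f → p₂ ∘ k ≡ g → k ≡ ⟨ f , g ⟩

  _×₁_ : ∀ {a b a' b'} → Hom a a' → Hom b b' → Hom (a ⊗ b) (a' ⊗ b')
  f ×₁ g = ⟨ f ∘ p₁ , g ∘ p₂ ⟩

  Δ : ∀ {a} → Hom a (a ⊗ a)
  Δ = ⟨ id , id ⟩

  α : ∀ {e d c} → Hom ((e ⊗ d) ⊗ c) (e ⊗ (d ⊗ c))
  α = ⟨ p₁ ∘ p₁ , ⟨ p₂ ∘ p₁ , p₂ ⟩ ⟩

-- Bounded distributive lattice structure on a preorder.
-- (A poset is the posetal reflection of a preorder; equality there is
--  x ≈ y := x ≤ y × y ≤ x.)

record IsDLat {a l : Level} (A : Set a) (_≤_ : A → A → Set l) : Set (a ⊔ l) where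
  field
    refl  : ∀ {x} → x ≤ x
    trans : ∀ {x y z} → x ≤ y → y ≤ z → x ≤ z
    ⊤ ⊥ : A
    _∧_ _∨_ : A → A → A
    ⊤-max : ∀ x → x ≤ ⊤
    ⊥-min : ∀ x → ⊥ ≤ x
    ∧-lb₁ : ∀ x y → (x ∧ y) ≤ x
    ∧-lb₂ : ∀ x y → (x ∧ y) ≤ y
    ∧-glb : ∀ {x y z} → z ≤ x → z ≤ y → z ≤ (x ∧ y)
    ∨-ub₁ : ∀ x y → x ≤ (x ∨ y)
    ∨-ub₂ : ∀ x y → y ≤ (x ∨ y)
    ∨-lub : ∀ {x y z} → x ≤ z → y ≤ z → (x ∨ y) ≤ z
    distrib : ∀ x y z → (x ∧ (y ∨ z)) ≤ ((x ∧ y) ∨ (x ∧ z))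

record PreDoctrine {o h : Level} (C : Cat o h) (p l : Level)
       : Set (o ⊔ h ⊔ lsuc (p ⊔ l)) where
  open Cat C
  field
    P   : Obj → Set p
    _≤_ : ∀ {c} → P c → P c → Set l
    _* : ∀ {c' c} → Hom c' c → P c → P c'

  _≈_ : ∀ {c} → P c → P c → Set l
  x ≈ y = x ≤ y × y ≤ x

record IsDoctrine {o h p l : Level} (C : Cat o h) (D : PreDoctrine C p l)
       : Set (o ⊔ h ⊔ p ⊔ l) where
  open Cat C
  open PreDoctrine D
  field
    lat : ∀ c → IsDLat (P c) (_≤_ {c})
  open module L {c} = IsDLat (lat c) using (⊤; ⊥; _∧_; _∨_)
  field
    *-mono : ∀ {c' c} (f : Hom c' c) {x y : P c} → x ≤ y → (f *) x ≤ (f *) y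
    *-⊤ : ∀ {c' c} (f : Hom c' c) → (f *) ⊤ ≈ ⊤
    *-⊥ : ∀ {c' c} (f : Hom c' c) → (f *) ⊥ ≈ ⊥
    *-∧ : ∀ {c' c} (f : Hom c' c) (x y : P c) → (f *) (x ∧ y) ≈ ((f *) x ∧ (f *) y)
    *-∨ : ∀ {c' c} (f : Hom c' c) (x y : P c) → (f *) (x ∨ y) ≈ ((f *) x ∨ (f *) y)
    *-id : ∀ {c} (x : P c) → (id *) x ≈ x
    *-∘ : ∀ {c'' c' c} (g : Hom c' c) (f : Hom c'' c') (x : P c) →
          ((g ∘ f) *) x ≈ (f *) ((g *) x)

-- Equality predicates: δ_d ∈ P(d × d) such that for every d',
--   π_d*(-) ∧ π_{d'}* δ_d  ⊣  (1_{d'} × Δ_d)*  :  P(d' × d) ⇄ P(d' × (d × d))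
-- where π_d = 1_{d'} × p₁ : d' × (d × d) → d' × d forgets the second copy
-- of d, and π_{d'} = p₂ : d' × (d × d) → d × d forgets d'.

record HasEq {o h p l : Level} (C : Cat o h) (D : PreDoctrine C p l)
       (isD : IsDoctrine C D) (δ : ∀ d → PreDoctrine.P D (Cat._⊗_ C d d))
       : Set (o ⊔ h ⊔ p ⊔ l) where
  open Cat C
  open PreDoctrine D
  open IsDoctrine isD hiding (module L)
  open module L {c} = IsDLat (lat c) using (⊤; ⊥; _∧_; _∨_)
  field
    eq-adj : ∀ d' d (x : P (d' ⊗ d)) (y : P (d' ⊗ (d ⊗ d))) →
             ((((id ×₁ p₁) *) x ∧ (p₂ *) (δ d)) ≤ y) ⇔ (x ≤ ((id ×₁ Δ) *) y)

record HasExists {o h p l : Level} (C : Cat o h) (D : PreDoctrine C p l)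
       (isD : IsDoctrine C D)
       (Σd : ∀ d c → PreDoctrine.P D (Cat._⊗_ C d c) → PreDoctrine.P D c)
       : Set (o ⊔ h ⊔ p ⊔ l) where
  open Cat C
  open PreDoctrine D
  open IsDoctrine isD hiding (module L)
  open module L {c} = IsDLat (lat c) using (⊤; ⊥; _∧_; _∨_)
  field
    ∃-adj : ∀ d c (x : P (d ⊗ c)) (y : P c) → (Σd d c x ≤ y) ⇔ (x ≤ (p₂ *) y)
    frobenius : ∀ d c (x : P c) (y : P (d ⊗ c)) →
                (x ∧ Σd d c y) ≈ Σd d c ((p₂ *) x ∧ y)
    beck-chevalley : ∀ d {c' c} (f : Hom c' c) (x : P (d ⊗ c)) →
                     (f *) (Σd d c x) ≈ Σd d c' (((id ×₁ f) *) x)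

module Completion {o h p l : Level} (C : Cat o h) (D : PreDoctrine C p l)
       (isD : IsDoctrine C D) where
  open Cat C
  open PreDoctrine D
  open IsDoctrine isD hiding (module L)
  open module L {c} = IsDLat (lat c) using (⊤; ⊥; _∧_; _∨_)

  Gen : Obj → Set (o ⊔ p)
  Gen c = Σ Obj (λ d → P (d ⊗ c))

  -- elements of P^∃(c) (before posetal reflection): finite sets, as lists
  PE : Obj → Set (o ⊔ p)
  PE c = List (Gen c)

  Witness : ∀ {c} → Obj → PE c → Set (o ⊔ h ⊔ p)
  Witness {c} d ys =
    Σ (Gen c) λ ey → (ey ∈ ys) ×
      Σ (Hom (d ⊗ c) (proj₁ ey ⊗ c)) λ r → p₂ ∘ r ≡ p₂

  joinW : ∀ {c d} {ys : PE c} → List (Witness d ys) → P (d ⊗ c)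
  joinW [] = ⊥
  joinW ((ey , _ , r , _) ∷ ws) = ((r *) (proj₂ ey)) ∨ joinW ws

  Covered : ∀ {c} → Gen c → PE c → Set (o ⊔ h ⊔ p ⊔ l)
  Covered (d , x) ys = Σ (List (Witness d ys)) λ ws → x ≤ joinW ws

  data AllCovered {c} (ys : PE c) : PE c → Set (o ⊔ h ⊔ p ⊔ l) where
    []  : AllCovered ys []
    _∷_ : ∀ {g xs} → Covered g ys → AllCovered ys xs → AllCovered ys (g ∷ xs)

  _≤E_ : ∀ {c} → PE c → PE c → Set (o ⊔ h ⊔ p ⊔ l)
  xs ≤E ys = AllCovered ys xs

  reindexE : ∀ {c' c} → Hom c' c → PE c → PE c'
  reindexE f = map (λ { (d , x) → d , ((id ×₁ f) *) x })

  PreDoctrineE : PreDoctrine C (o ⊔ p) (o ⊔ h ⊔ p ⊔ l)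
  PreDoctrineE = record { P = PE ; _≤_ = _≤E_ ; _* = reindexE }

  -- Σ_d : P^∃(d × c) → P^∃(c),  {(e , x)} ↦ {(e × d , x)}
  -- (x ∈ P(e × (d × c)) is transported along (e × d) × c ≅ e × (d × c))
  ΣE : ∀ d c → PE (d ⊗ c) → PE c
  ΣE d c = map (λ { (e , x) → (e ⊗ d) , (α *) x })

  -- {(1 , δ_d)} with 1 × (d × d) ≅ d × d
  δE : (∀ d → P (d ⊗ d)) → ∀ d → PE (d ⊗ d)
  δE δ d = (𝟙 , (p₂ *) (δ d)) ∷ []

{-# OPTIONS --safe #-}
module Submission where

-- An element of P^∃(c) is a finite join of formal existentials ∃e. x with x ∈ P(e × c), and
-- ∃e. x lies below ⋁ⱼ ∃eⱼ. yⱼ as soon as x is below a finite join of reindexings of the yⱼ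
-- along maps e × c → eⱼ × c over c. Every law is therefore checked one generator at a time by
-- exhibiting such maps: meets multiply the bound objects, Σ_d moves d from the context into
-- the bound object, and both commute with reindexing up to associativity isomorphisms.
-- For equality, moving the bound e of a generator ∃e. a of P^∃(d' × d) (together with the 1
-- bound in {(1, δ_d)}) and d' into the context (e × 1) × d' turns both sides of the required
-- adjunction into the two sides of the equality adjunction of P in that context.

open import Level using (Level)
open import Defs
open import Data.Product using (Σ; _×_; _,_; proj₁; proj₂)
open import Data.List using (List; []; _∷_; map; _++_; cartesianProductWith)
open import Data.List.Properties using (map-++)
open import Data.List.Membership.Propositional using (_∈_)
open import Data.List.Membership.Propositional.Properties
  using (∈-map⁺; ∈-map⁻; ∈-++⁺ˡ; ∈-++⁺ʳ; ∈-++⁻; ∈-cartesianProductWith⁺; ∈-cartesianProductWith⁻)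
open import Data.List.Relation.Binary.Subset.Propositional using (_⊆_)
open import Data.List.Relation.Binary.Subset.Propositional.Properties using (xs⊆xs++ys; xs⊆ys++xs)
open import Data.List.Relation.Unary.All as All using (All; []; _∷_)
import Data.List.Relation.Unary.All.Properties as All
open import Data.List.Relation.Unary.Any using (here)
open import Data.Sum using (inj₁; inj₂)
open import Relation.Binary.PropositionalEquality
  using (_≡_; refl; sym; trans; cong; cong₂; module ≡-Reasoning)
open import Function.Bundles using (mk⇔; Equivalence)

module ProductLemmas {o h : Level} (C : Cat o h) where
  open Cat C
  open ≡-Reasoning

  ⟨⟩∘ : ∀ {a b c d} (f : Hom c a) (g : Hom c b) (k : Hom d c) → ⟨ f , g ⟩ ∘ k ≡ ⟨ f ∘ k , g ∘ k ⟩
  ⟨⟩∘ f g k = ⟨⟩-unique (f ∘ k) (g ∘ k) (⟨ f , g ⟩ ∘ k)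
    (trans (sym (assoc p₁ ⟨ f , g ⟩ k)) (cong (_∘ k) (β₁ f g)))
    (trans (sym (assoc p₂ ⟨ f , g ⟩ k)) (cong (_∘ k) (β₂ f g)))

  ⟨⟩-η : ∀ {a b c} (k : Hom c (a ⊗ b)) → ⟨ p₁ ∘ k , p₂ ∘ k ⟩ ≡ k
  ⟨⟩-η k = sym (⟨⟩-unique _ _ k refl refl)

  ⟨p₁,p₂⟩≡id : ∀ {a b} → ⟨ p₁ , p₂ ⟩ ≡ id {a ⊗ b}
  ⟨p₁,p₂⟩≡id = sym (⟨⟩-unique p₁ p₂ id (identityʳ p₁) (identityʳ p₂))

  ×₁∘⟨⟩ : ∀ {a b a' b' c} (f : Hom a a') (g : Hom b b') (u : Hom c a) (v : Hom c b) →
          (f ×₁ g) ∘ ⟨ u , v ⟩ ≡ ⟨ f ∘ u , g ∘ v ⟩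
  ×₁∘⟨⟩ f g u v = trans (⟨⟩∘ _ _ _) (cong₂ ⟨_,_⟩
    (trans (assoc f p₁ _) (cong (f ∘_) (β₁ u v))) (trans (assoc g p₂ _) (cong (g ∘_) (β₂ u v))))

  ×₁∘×₁ : ∀ {a b a' b' a'' b''} (f : Hom a' a'') (g : Hom b' b'') (f' : Hom a a') (g' : Hom b b') →
          (f ×₁ g) ∘ (f' ×₁ g') ≡ (f ∘ f') ×₁ (g ∘ g')
  ×₁∘×₁ f g f' g' = trans (×₁∘⟨⟩ f g _ _) (cong₂ ⟨_,_⟩ (sym (assoc f f' p₁)) (sym (assoc g g' p₂)))

  id×₁id : ∀ {a b} → id {a} ×₁ id {b} ≡ id
  id×₁id = trans (cong₂ ⟨_,_⟩ (identityˡ p₁) (identityˡ p₂)) ⟨p₁,p₂⟩≡id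

  id×₁∘ : ∀ {a b b' b''} (g : Hom b' b'') (f : Hom b b') → id {a} ×₁ (g ∘ f) ≡ (id ×₁ g) ∘ (id ×₁ f)
  id×₁∘ g f = trans (cong (_×₁ (g ∘ f)) (sym (identityˡ id))) (sym (×₁∘×₁ _ _ _ _))

  ×₁-interchange : ∀ {a a' b b'} (f : Hom a a') (g : Hom b b') →
                   (f ×₁ id) ∘ (id ×₁ g) ≡ (id ×₁ g) ∘ (f ×₁ id)
  ×₁-interchange f g = begin
    (f ×₁ id) ∘ (id ×₁ g)  ≡⟨ ×₁∘×₁ f id id g ⟩
    (f ∘ id) ×₁ (id ∘ g)   ≡⟨ cong₂ _×₁_ (trans (identityʳ f) (sym (identityˡ f)))
                                          (trans (identityˡ g) (sym (identityʳ g))) ⟩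
    (id ∘ f) ×₁ (g ∘ id)   ≡⟨ sym (×₁∘×₁ id g f id) ⟩
    (id ×₁ g) ∘ (f ×₁ id)  ∎

  p₁∘-×₁ : ∀ {a b a' b' x} (k : Hom a' x) (g : Hom a a') (h : Hom b b') → (k ∘ p₁) ∘ (g ×₁ h) ≡ k ∘ (g ∘ p₁)
  p₁∘-×₁ k g h = trans (assoc _ _ _) (cong (k ∘_) (β₁ _ _))

  p₂∘-×₁ : ∀ {a b a' b' x} (k : Hom b' x) (g : Hom a a') (h : Hom b b') → (k ∘ p₂) ∘ (g ×₁ h) ≡ k ∘ (h ∘ p₂)
  p₂∘-×₁ k g h = trans (assoc _ _ _) (cong (k ∘_) (β₂ _ _))

  factor-over : ∀ {a b y y'} (k : Hom (a ⊗ y') (b ⊗ y)) (m : Hom y' y) → p₂ ∘ k ≡ m ∘ p₂ →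
                k ≡ (id ×₁ m) ∘ ⟨ p₁ ∘ k , p₂ ⟩
  factor-over k m e = sym (trans (×₁∘⟨⟩ _ _ _ _) (trans (cong₂ ⟨_,_⟩ (identityˡ _) (sym e)) (⟨⟩-η k)))

  over-∘ : ∀ {a b e c} {s : Hom (b ⊗ c) (e ⊗ c)} {r : Hom (a ⊗ c) (b ⊗ c)} →
           p₂ ∘ s ≡ p₂ → p₂ ∘ r ≡ p₂ → p₂ ∘ (s ∘ r) ≡ p₂
  over-∘ {s = s} {r} e₁ e₂ = trans (sym (assoc _ _ _)) (trans (cong (_∘ r) e₁) e₂)

  α⁻¹ : ∀ {e d c} → Hom (e ⊗ (d ⊗ c)) ((e ⊗ d) ⊗ c)
  α⁻¹ = ⟨ ⟨ p₁ , p₁ ∘ p₂ ⟩ , p₂ ∘ p₂ ⟩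

  α∘⟨⟨⟩⟩ : ∀ {e d c x} (u : Hom x e) (v : Hom x d) (w : Hom x c) → α ∘ ⟨ ⟨ u , v ⟩ , w ⟩ ≡ ⟨ u , ⟨ v , w ⟩ ⟩
  α∘⟨⟨⟩⟩ u v w = trans (⟨⟩∘ _ _ _) (cong₂ ⟨_,_⟩
    (trans (assoc _ _ _) (trans (cong (p₁ ∘_) (β₁ _ _)) (β₁ _ _)))
    (trans (⟨⟩∘ _ _ _) (cong₂ ⟨_,_⟩ (trans (assoc _ _ _) (trans (cong (p₂ ∘_) (β₁ _ _)) (β₂ _ _))) (β₂ _ _))))

  α∘α⁻¹ : ∀ {e d c} → α {e} {d} {c} ∘ α⁻¹ ≡ id
  α∘α⁻¹ = trans (α∘⟨⟨⟩⟩ _ _ _) (trans (cong ⟨ p₁ ,_⟩ (⟨⟩-η p₂)) ⟨p₁,p₂⟩≡id)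

  p₂∘α : ∀ {e d c} → p₂ ∘ α {e} {d} {c} ≡ p₂ ×₁ id
  p₂∘α = trans (β₂ _ _) (cong ⟨ p₂ ∘ p₁ ,_⟩ (sym (identityˡ p₂)))

  p₂×₁id∘α⁻¹ : ∀ {e d c} → (p₂ ×₁ id) ∘ α⁻¹ {e} {d} {c} ≡ p₂
  p₂×₁id∘α⁻¹ = trans (×₁∘⟨⟩ p₂ id _ _) (trans (cong₂ ⟨_,_⟩ (β₂ _ _) (identityˡ _)) (⟨⟩-η p₂))

  α-natural : ∀ {e d c c'} (f : Hom c' c) → α {e} {d} ∘ (id ×₁ f) ≡ (id ×₁ (id ×₁ f)) ∘ α
  α-natural f = trans (⟨⟩∘ _ _ _) (trans
    (cong₂ ⟨_,_⟩ (trans (p₁∘-×₁ _ _ _) (cong (p₁ ∘_) (identityˡ _)))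
                 (trans (⟨⟩∘ _ _ _) (cong₂ ⟨_,_⟩ (trans (p₁∘-×₁ _ _ _) (cong (p₂ ∘_) (identityˡ _))) (β₂ _ _))))
    (sym (trans (×₁∘⟨⟩ _ _ _ _) (cong₂ ⟨_,_⟩ (identityˡ _) (trans (×₁∘⟨⟩ _ _ _ _) (cong₂ ⟨_,_⟩ (identityˡ _) refl))))))

  -- Identifies the bound objects of the generators of x ∧ Σ_d y and of Σ_d (π* x ∧ y).
  regroup : ∀ {e f d c} → Hom ((e ⊗ (f ⊗ d)) ⊗ c) (((e ⊗ f) ⊗ d) ⊗ c)
  regroup = ⟨ ⟨ ⟨ p₁ ∘ p₁ , p₁ ∘ (p₂ ∘ p₁) ⟩ , p₂ ∘ (p₂ ∘ p₁) ⟩ , p₂ ⟩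

  regroup⁻¹ : ∀ {e f d c} → Hom (((e ⊗ f) ⊗ d) ⊗ c) ((e ⊗ (f ⊗ d)) ⊗ c)
  regroup⁻¹ = ⟨ ⟨ p₁ ∘ (p₁ ∘ p₁) , ⟨ p₂ ∘ (p₁ ∘ p₁) , p₂ ∘ p₁ ⟩ ⟩ , p₂ ⟩

  α∘regroup : ∀ {e f d c} → α ∘ regroup {e} {f} {d} {c} ≡ ⟨ ⟨ p₁ ∘ p₁ , p₁ ∘ (p₂ ∘ p₁) ⟩ , ⟨ p₂ ∘ (p₂ ∘ p₁) , p₂ ⟩ ⟩
  α∘regroup = α∘⟨⟨⟩⟩ _ _ _

  regroup-fst : ∀ {e f d c} → p₁ ×₁ id ≡ ((id ×₁ p₂) ∘ (p₁ ×₁ id)) ∘ (α ∘ regroup {e} {f} {d} {c})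
  regroup-fst = sym (begin
    ((id ×₁ p₂) ∘ (p₁ ×₁ id)) ∘ (α ∘ regroup)
      ≡⟨ cong₂ _∘_ (×₁∘×₁ id p₂ p₁ id) α∘regroup ⟩
    ((id ∘ p₁) ×₁ (p₂ ∘ id)) ∘ ⟨ ⟨ p₁ ∘ p₁ , p₁ ∘ (p₂ ∘ p₁) ⟩ , ⟨ p₂ ∘ (p₂ ∘ p₁) , p₂ ⟩ ⟩
      ≡⟨ ×₁∘⟨⟩ _ _ _ _ ⟩
    ⟨ (id ∘ p₁) ∘ ⟨ p₁ ∘ p₁ , p₁ ∘ (p₂ ∘ p₁) ⟩ , (p₂ ∘ id) ∘ ⟨ p₂ ∘ (p₂ ∘ p₁) , p₂ ⟩ ⟩
      ≡⟨ cong₂ ⟨_,_⟩ (trans (cong (_∘ ⟨ p₁ ∘ p₁ , p₁ ∘ (p₂ ∘ p₁) ⟩) (identityˡ p₁)) (β₁ _ _))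
                     (trans (cong (_∘ ⟨ p₂ ∘ (p₂ ∘ p₁) , p₂ ⟩) (identityʳ p₂)) (β₂ _ _)) ⟩
    ⟨ p₁ ∘ p₁ , p₂ ⟩
      ≡⟨ cong ⟨ p₁ ∘ p₁ ,_⟩ (sym (identityˡ p₂)) ⟩
    p₁ ×₁ id ∎)

  regroup-snd : ∀ {e f d c} → α ∘ (p₂ ×₁ id) ≡ (p₂ ×₁ id) ∘ (α ∘ regroup {e} {f} {d} {c})
  regroup-snd = begin
    α ∘ (p₂ ×₁ id)
      ≡⟨ ⟨⟩∘ _ _ _ ⟩
    ⟨ (p₁ ∘ p₁) ∘ (p₂ ×₁ id) , ⟨ p₂ ∘ p₁ , p₂ ⟩ ∘ (p₂ ×₁ id) ⟩
      ≡⟨ cong₂ ⟨_,_⟩ (p₁∘-×₁ p₁ p₂ id)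
                     (trans (⟨⟩∘ _ _ _) (cong₂ ⟨_,_⟩ (p₁∘-×₁ p₂ p₂ id) (trans (β₂ _ _) (identityˡ p₂)))) ⟩
    ⟨ p₁ ∘ (p₂ ∘ p₁) , ⟨ p₂ ∘ (p₂ ∘ p₁) , p₂ ⟩ ⟩
      ≡⟨ sym (trans (×₁∘⟨⟩ p₂ id _ _) (cong₂ ⟨_,_⟩ (β₂ _ _) (identityˡ _))) ⟩
    (p₂ ×₁ id) ∘ ⟨ ⟨ p₁ ∘ p₁ , p₁ ∘ (p₂ ∘ p₁) ⟩ , ⟨ p₂ ∘ (p₂ ∘ p₁) , p₂ ⟩ ⟩
      ≡⟨ cong ((p₂ ×₁ id) ∘_) (sym α∘regroup) ⟩
    (p₂ ×₁ id) ∘ (α ∘ regroup) ∎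

  regroup⁻¹-fst : ∀ {e f d c} → ((id ×₁ p₂) ∘ (p₁ ×₁ id)) ∘ α ≡ (p₁ ×₁ id) ∘ regroup⁻¹ {e} {f} {d} {c}
  regroup⁻¹-fst = begin
    ((id ×₁ p₂) ∘ (p₁ ×₁ id)) ∘ α
      ≡⟨ cong (_∘ α) (×₁∘×₁ id p₂ p₁ id) ⟩
    ((id ∘ p₁) ×₁ (p₂ ∘ id)) ∘ α
      ≡⟨ ×₁∘⟨⟩ _ _ _ _ ⟩
    ⟨ (id ∘ p₁) ∘ (p₁ ∘ p₁) , (p₂ ∘ id) ∘ ⟨ p₂ ∘ p₁ , p₂ ⟩ ⟩
      ≡⟨ cong₂ ⟨_,_⟩ (cong (_∘ (p₁ ∘ p₁)) (identityˡ p₁)) 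
                     (trans (cong (_∘ ⟨ p₂ ∘ p₁ , p₂ ⟩) (identityʳ p₂)) (β₂ _ _)) ⟩
    ⟨ p₁ ∘ (p₁ ∘ p₁) , p₂ ⟩
      ≡⟨ sym (trans (×₁∘⟨⟩ p₁ id _ _) (cong₂ ⟨_,_⟩ (β₁ _ _) (identityˡ p₂))) ⟩
    (p₁ ×₁ id) ∘ regroup⁻¹ ∎

  regroup⁻¹-snd : ∀ {e f d c} → (p₂ ×₁ id) ∘ α ≡ (α ∘ (p₂ ×₁ id)) ∘ regroup⁻¹ {e} {f} {d} {c}
  regroup⁻¹-snd = begin
    (p₂ ×₁ id) ∘ α
      ≡⟨ ×₁∘⟨⟩ p₂ id _ _ ⟩
    ⟨ p₂ ∘ (p₁ ∘ p₁) , id ∘ ⟨ p₂ ∘ p₁ , p₂ ⟩ ⟩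
      ≡⟨ cong ⟨ p₂ ∘ (p₁ ∘ p₁) ,_⟩ (identityˡ _) ⟩
    ⟨ p₂ ∘ (p₁ ∘ p₁) , ⟨ p₂ ∘ p₁ , p₂ ⟩ ⟩
      ≡⟨ sym (α∘⟨⟨⟩⟩ _ _ _) ⟩
    α ∘ ⟨ ⟨ p₂ ∘ (p₁ ∘ p₁) , p₂ ∘ p₁ ⟩ , p₂ ⟩
      ≡⟨ cong (α ∘_) (sym (trans (×₁∘⟨⟩ p₂ id _ _) (cong₂ ⟨_,_⟩ (β₂ _ _) (identityˡ p₂)))) ⟩
    α ∘ ((p₂ ×₁ id) ∘ regroup⁻¹)
      ≡⟨ sym (assoc _ _ _) ⟩
    (α ∘ (p₂ ×₁ id)) ∘ regroup⁻¹ ∎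

  -- (e × 1) × d' is the context in which the equality adjunction of P is used.
  unpack : ∀ {e d' d} → Hom (((e ⊗ 𝟙) ⊗ d') ⊗ d) (e ⊗ (d' ⊗ d))
  unpack = (p₁ ×₁ id) ∘ α

  pack : ∀ {e d' d} → Hom (e ⊗ (d' ⊗ d)) (((e ⊗ 𝟙) ⊗ d') ⊗ d)
  pack = α⁻¹ ∘ (⟨ id , ! ⟩ ×₁ id)

  unpack∘pack : ∀ {e d' d} → unpack {e} {d'} {d} ∘ pack ≡ id
  unpack∘pack = begin
    ((p₁ ×₁ id) ∘ α) ∘ (α⁻¹ ∘ (⟨ id , ! ⟩ ×₁ id))
      ≡⟨ assoc _ _ _ ⟩
    (p₁ ×₁ id) ∘ (α ∘ (α⁻¹ ∘ (⟨ id , ! ⟩ ×₁ id)))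
      ≡⟨ cong ((p₁ ×₁ id) ∘_) (trans (sym (assoc _ _ _)) (trans (cong (_∘ (⟨ id , ! ⟩ ×₁ id)) α∘α⁻¹) (identityˡ _))) ⟩
    (p₁ ×₁ id) ∘ (⟨ id , ! ⟩ ×₁ id)
      ≡⟨ ×₁∘×₁ _ _ _ _ ⟩
    (p₁ ∘ ⟨ id , ! ⟩) ×₁ (id ∘ id)
      ≡⟨ cong₂ _×₁_ (β₁ _ _) (identityˡ id) ⟩
    id ×₁ id
      ≡⟨ id×₁id ⟩
    id ∎

  unpack∘id×₁p₁ : ∀ {e d' d} → unpack {e} {d'} {d} ∘ (id ×₁ p₁ {d} {d}) ≡ ((id ×₁ (id ×₁ p₁)) ∘ (p₁ ×₁ id)) ∘ α
  unpack∘id×₁p₁ = begin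
    ((p₁ ×₁ id) ∘ α) ∘ (id ×₁ p₁)          ≡⟨ assoc _ _ _ ⟩
    (p₁ ×₁ id) ∘ (α ∘ (id ×₁ p₁))          ≡⟨ cong ((p₁ ×₁ id) ∘_) (α-natural p₁) ⟩
    (p₁ ×₁ id) ∘ ((id ×₁ (id ×₁ p₁)) ∘ α)  ≡⟨ sym (assoc _ _ _) ⟩
    ((p₁ ×₁ id) ∘ (id ×₁ (id ×₁ p₁))) ∘ α  ≡⟨ cong (_∘ α) (×₁-interchange p₁ (id ×₁ p₁)) ⟩
    ((id ×₁ (id ×₁ p₁)) ∘ (p₁ ×₁ id)) ∘ α  ∎

  p₂≡p₂∘id×₁p₂∘p₂×₁id∘α : ∀ {e a b c} → p₂ ≡ ((p₂ ∘ (id {a} ×₁ p₂)) ∘ (p₂ ×₁ id)) ∘ α {e ⊗ a} {b} {c}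
  p₂≡p₂∘id×₁p₂∘p₂×₁id∘α = sym (begin
    ((p₂ ∘ (id ×₁ p₂)) ∘ (p₂ ×₁ id)) ∘ α  ≡⟨ cong (λ k → (k ∘ (p₂ ×₁ id)) ∘ α) (β₂ _ _) ⟩
    ((p₂ ∘ p₂) ∘ (p₂ ×₁ id)) ∘ α          ≡⟨ cong (_∘ α) (trans (p₂∘-×₁ p₂ p₂ id) (cong (p₂ ∘_) (identityˡ p₂))) ⟩
    (p₂ ∘ p₂) ∘ α                         ≡⟨ assoc _ _ _ ⟩
    p₂ ∘ (p₂ ∘ α)                         ≡⟨ cong (p₂ ∘_) p₂∘α ⟩
    p₂ ∘ (p₂ ×₁ id)                       ≡⟨ trans (β₂ _ _) (identityˡ p₂) ⟩
    p₂                                    ∎)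

  pack-diag : ∀ {e d' d} → Hom (e ⊗ (d' ⊗ d)) ((e ⊗ 𝟙) ⊗ (d' ⊗ (d ⊗ d)))
  pack-diag = α ∘ ((id ×₁ Δ) ∘ pack)

  p₂∘pack-diag : ∀ {e d' d} → p₂ ∘ pack-diag {e} {d'} {d} ≡ (id ×₁ Δ) ∘ p₂
  p₂∘pack-diag = begin
    p₂ ∘ (α ∘ ((id ×₁ Δ) ∘ pack))      ≡⟨ sym (assoc _ _ _) ⟩
    (p₂ ∘ α) ∘ ((id ×₁ Δ) ∘ pack)      ≡⟨ cong (_∘ ((id ×₁ Δ) ∘ pack)) p₂∘α ⟩
    (p₂ ×₁ id) ∘ ((id ×₁ Δ) ∘ pack)    ≡⟨ sym (assoc _ _ _) ⟩
    ((p₂ ×₁ id) ∘ (id ×₁ Δ)) ∘ pack    ≡⟨ cong (_∘ pack) (×₁-interchange p₂ Δ) ⟩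
    ((id ×₁ Δ) ∘ (p₂ ×₁ id)) ∘ pack    ≡⟨ assoc _ _ _ ⟩
    (id ×₁ Δ) ∘ ((p₂ ×₁ id) ∘ pack)    ≡⟨ cong ((id ×₁ Δ) ∘_) p₂×₁id∘pack ⟩
    (id ×₁ Δ) ∘ p₂                     ∎
    where
    p₂×₁id∘pack : (p₂ ×₁ id) ∘ (α⁻¹ ∘ (⟨ id , ! ⟩ ×₁ id)) ≡ p₂
    p₂×₁id∘pack = trans (sym (assoc _ _ _))
      (trans (cong (_∘ (⟨ id , ! ⟩ ×₁ id)) p₂×₁id∘α⁻¹) (trans (β₂ _ _) (identityˡ p₂)))

  contract : ∀ {e d' d} → Hom ((e ⊗ 𝟙) ⊗ (d' ⊗ (d ⊗ d))) (e ⊗ (d' ⊗ d))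
  contract = p₁ ×₁ (id ×₁ p₁)

  contract∘α∘id×₁Δ : ∀ {e d' d} → contract ∘ (α ∘ (id ×₁ Δ)) ≡ unpack {e} {d'} {d}
  contract∘α∘id×₁Δ = begin
    contract ∘ (α ∘ (id ×₁ Δ))                            ≡⟨ cong (contract ∘_) (α-natural Δ) ⟩
    contract ∘ ((id ×₁ (id ×₁ Δ)) ∘ α)                    ≡⟨ sym (assoc _ _ _) ⟩
    (contract ∘ (id ×₁ (id ×₁ Δ))) ∘ α                    ≡⟨ cong (_∘ α) (×₁∘×₁ _ _ _ _) ⟩
    ((p₁ ∘ id) ×₁ ((id ×₁ p₁) ∘ (id ×₁ Δ))) ∘ α           ≡⟨ cong (λ k → ((p₁ ∘ id) ×₁ k) ∘ α) id×₁p₁∘id×₁Δ ⟩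
    ((p₁ ∘ id) ×₁ id) ∘ α                                 ≡⟨ cong (λ k → (k ×₁ id) ∘ α) (identityʳ p₁) ⟩
    (p₁ ×₁ id) ∘ α                                        ∎
    where
    id×₁p₁∘id×₁Δ : ∀ {a b} → (id {a} ×₁ p₁) ∘ (id ×₁ Δ {b}) ≡ id
    id×₁p₁∘id×₁Δ = trans (×₁∘×₁ _ _ _ _) (trans (cong₂ _×₁_ (identityˡ id) (β₁ id id)) id×₁id)

  p₂∘α∘id×₁Δ : ∀ {e d' d} → p₂ ∘ (α ∘ (id ×₁ Δ)) ≡ (id ×₁ Δ) ∘ (p₂ ∘ unpack {e} {d'} {d})
  p₂∘α∘id×₁Δ = begin
    p₂ ∘ (α ∘ (id ×₁ Δ))        ≡⟨ sym (assoc _ _ _) ⟩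
    (p₂ ∘ α) ∘ (id ×₁ Δ)        ≡⟨ cong (_∘ (id ×₁ Δ)) p₂∘α ⟩
    (p₂ ×₁ id) ∘ (id ×₁ Δ)      ≡⟨ ×₁-interchange p₂ Δ ⟩
    (id ×₁ Δ) ∘ (p₂ ×₁ id)      ≡⟨ cong ((id ×₁ Δ) ∘_) (sym p₂∘unpack) ⟩
    (id ×₁ Δ) ∘ (p₂ ∘ unpack)   ∎
    where
    p₂∘unpack : p₂ ∘ ((p₁ ×₁ id) ∘ α) ≡ p₂ ×₁ id
    p₂∘unpack = trans (sym (assoc _ _ _)) (trans (cong (_∘ α) (trans (β₂ _ _) (identityˡ p₂))) p₂∘α)

  -- A witness over 1 × Δ extends to all of d' × (d × d) by forgetting the second copy of d.
  diagonal-lift : ∀ {e e' d' d} (t : Hom (e ⊗ (d' ⊗ d)) (e' ⊗ (d' ⊗ d))) → p₂ ∘ t ≡ p₂ →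
                  ((id ×₁ (id ×₁ Δ)) ∘ t) ∘ unpack ≡ ⟨ p₁ ∘ (t ∘ contract) , p₂ ⟩ ∘ (α ∘ (id ×₁ Δ))
  diagonal-lift t t-over = begin
    ((id ×₁ (id ×₁ Δ)) ∘ t) ∘ unpack
      ≡⟨ assoc _ _ _ ⟩
    (id ×₁ (id ×₁ Δ)) ∘ (t ∘ unpack)
      ≡⟨ cong ((id ×₁ (id ×₁ Δ)) ∘_) (sym (⟨⟩-η (t ∘ unpack))) ⟩
    (id ×₁ (id ×₁ Δ)) ∘ ⟨ p₁ ∘ (t ∘ unpack) , p₂ ∘ (t ∘ unpack) ⟩
      ≡⟨ ×₁∘⟨⟩ _ _ _ _ ⟩
    ⟨ id ∘ (p₁ ∘ (t ∘ unpack)) , (id ×₁ Δ) ∘ (p₂ ∘ (t ∘ unpack)) ⟩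
      ≡⟨ cong₂ ⟨_,_⟩ (identityˡ _) (cong ((id ×₁ Δ) ∘_) (trans (sym (assoc _ _ _)) (cong (_∘ unpack) t-over))) ⟩
    ⟨ p₁ ∘ (t ∘ unpack) , (id ×₁ Δ) ∘ (p₂ ∘ unpack) ⟩
      ≡⟨ cong₂ ⟨_,_⟩ (cong (λ k → p₁ ∘ (t ∘ k)) (sym contract∘α∘id×₁Δ)) (sym p₂∘α∘id×₁Δ) ⟩
    ⟨ p₁ ∘ (t ∘ (contract ∘ (α ∘ (id ×₁ Δ)))) , p₂ ∘ (α ∘ (id ×₁ Δ)) ⟩
      ≡⟨ cong ⟨_, p₂ ∘ (α ∘ (id ×₁ Δ)) ⟩ (sym (trans (assoc _ _ _) (cong (p₁ ∘_) (assoc _ _ _)))) ⟩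
    ⟨ (p₁ ∘ (t ∘ contract)) ∘ (α ∘ (id ×₁ Δ)) , p₂ ∘ (α ∘ (id ×₁ Δ)) ⟩
      ≡⟨ sym (⟨⟩∘ _ _ _) ⟩
    ⟨ p₁ ∘ (t ∘ contract) , p₂ ⟩ ∘ (α ∘ (id ×₁ Δ)) ∎

module DoctrineLemmas {o h p l : Level} (C : Cat o h) (D : PreDoctrine C p l) (isD : IsDoctrine C D) where
  open Cat C
  open PreDoctrine D
  open IsDoctrine isD hiding (module L)
  module Lat {c} = IsDLat (lat c)
  open Lat using (_∧_; _∨_)

  infixr 5 _⟫_
  _⟫_ : ∀ {c} {x y z : P c} → x ≤ y → y ≤ z → x ≤ z
  _⟫_ = Lat.trans

  ∧-mono : ∀ {c} {a a' b b' : P c} → a ≤ a' → b ≤ b' → (a ∧ b) ≤ (a' ∧ b')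
  ∧-mono a≤ b≤ = Lat.∧-glb (Lat.∧-lb₁ _ _ ⟫ a≤) (Lat.∧-lb₂ _ _ ⟫ b≤)

  ∨-mono : ∀ {c} {a a' b b' : P c} → a ≤ a' → b ≤ b' → (a ∨ b) ≤ (a' ∨ b')
  ∨-mono a≤ b≤ = Lat.∨-lub (a≤ ⟫ Lat.∨-ub₁ _ _) (b≤ ⟫ Lat.∨-ub₂ _ _)

  ∧-comm : ∀ {c} {a b : P c} → (a ∧ b) ≤ (b ∧ a)
  ∧-comm = Lat.∧-glb (Lat.∧-lb₂ _ _) (Lat.∧-lb₁ _ _)

  distribʳ : ∀ {c} (a b d : P c) → ((a ∨ b) ∧ d) ≤ ((a ∧ d) ∨ (b ∧ d))
  distribʳ a b d = ∧-comm ⟫ Lat.distrib d a b ⟫ ∨-mono ∧-comm ∧-comm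

  *-cong : ∀ {c c'} {f g : Hom c' c} {x : P c} → f ≡ g → (f *) x ≤ (g *) x
  *-cong refl = Lat.refl

  *-id≤ : ∀ {c} {x : P c} → (id *) x ≤ x
  *-id≤ = proj₁ (*-id _)

  *-id≥ : ∀ {c} {x : P c} → x ≤ (id *) x
  *-id≥ = proj₂ (*-id _)

  *-∘≤ : ∀ {c'' c' c} (g : Hom c' c) (f : Hom c'' c') {x : P c} → ((g ∘ f) *) x ≤ (f *) ((g *) x)
  *-∘≤ g f = proj₁ (*-∘ g f _)

  *-∘≥ : ∀ {c'' c' c} (g : Hom c' c) (f : Hom c'' c') {x : P c} → (f *) ((g *) x) ≤ ((g ∘ f) *) x
  *-∘≥ g f = proj₂ (*-∘ g f _)

  *-∘₃≤ : ∀ {a b b' c} {g : Hom b' c} {f : Hom b b'} {m : Hom a b} {x : P c} →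
          (((g ∘ f) ∘ m) *) x ≤ (m *) ((f *) ((g *) x))
  *-∘₃≤ {g = g} {f} {m} = *-∘≤ (g ∘ f) m ⟫ *-mono m (*-∘≤ g f)

  *-∘₃≥ : ∀ {a b b' c} {g : Hom b' c} {f : Hom b b'} {m : Hom a b} {x : P c} →
          (m *) ((f *) ((g *) x)) ≤ (((g ∘ f) ∘ m) *) x
  *-∘₃≥ {g = g} {f} {m} = *-mono m (*-∘≥ g f) ⟫ *-∘≥ (g ∘ f) m

  *-square : ∀ {a b b' c} {g : Hom b c} {f : Hom a b} {g' : Hom b' c} {f' : Hom a b'} {x : P c} →
             g ∘ f ≡ g' ∘ f' → (f *) ((g *) x) ≤ (f' *) ((g' *) x)
  *-square {g = g} {f} {g'} {f'} eq = *-∘≥ g f ⟫ *-cong eq ⟫ *-∘≤ g' f'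

  *-section≥ : ∀ {a b} {g : Hom b a} {f : Hom a b} {x : P a} → g ∘ f ≡ id → x ≤ (f *) ((g *) x)
  *-section≥ {g = g} {f} eq = *-id≥ ⟫ *-cong (sym eq) ⟫ *-∘≤ g f

  *-section≤ : ∀ {a b} {g : Hom b a} {f : Hom a b} {x : P a} → g ∘ f ≡ id → (f *) ((g *) x) ≤ x
  *-section≤ {g = g} {f} eq = *-∘≥ g f ⟫ *-cong eq ⟫ *-id≤

  *-∧≤ : ∀ {c c'} (f : Hom c' c) {a b : P c} → (f *) (a ∧ b) ≤ ((f *) a ∧ (f *) b)
  *-∧≤ f = proj₁ (*-∧ f _ _)

  *-∧≥ : ∀ {c c'} (f : Hom c' c) {a b : P c} → ((f *) a ∧ (f *) b) ≤ (f *) (a ∧ b)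
  *-∧≥ f = proj₂ (*-∧ f _ _)

module ExistentialCompletion {o h p l : Level} (C : Cat o h) (D : PreDoctrine C p l) (isD : IsDoctrine C D) where
  open Cat C
  open PreDoctrine D
  open IsDoctrine isD hiding (module L)
  open ProductLemmas C
  open DoctrineLemmas C D isD
  open Lat using (⊤; ⊥; _∧_; _∨_)
  open Completion C D isD
  open ≡-Reasoning

  reindexed : ∀ {c d} {ys : PE c} → Witness d ys → P (d ⊗ c)
  reindexed ((_ , y) , _ , r , _) = (r *) y

  ≤E⇒All : ∀ {c} {xs ys : PE c} → xs ≤E ys → All (λ g → Covered g ys) xs
  ≤E⇒All [] = []
  ≤E⇒All (cv ∷ cvs) = cv ∷ ≤E⇒All cvs

  All⇒≤E : ∀ {c} {xs ys : PE c} → All (λ g → Covered g ys) xs → xs ≤E ys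
  All⇒≤E [] = []
  All⇒≤E (cv ∷ cvs) = cv ∷ All⇒≤E cvs

  joinW-++ : ∀ {c d} {ys : PE c} (ws vs : List (Witness d ys)) → (joinW ws ∨ joinW vs) ≤ joinW (ws ++ vs)
  joinW-++ [] vs = Lat.∨-lub (Lat.⊥-min _) Lat.refl
  joinW-++ (w ∷ ws) vs = Lat.∨-lub
    (Lat.∨-lub (Lat.∨-ub₁ _ _) (Lat.∨-ub₁ _ _ ⟫ joinW-++ ws vs ⟫ Lat.∨-ub₂ _ _))
    (Lat.∨-ub₂ _ _ ⟫ joinW-++ ws vs ⟫ Lat.∨-ub₂ _ _)

  joinW-map : ∀ {c c' d d' a} {ys : PE c} {ys' : PE c'} (g : Hom a (d ⊗ c)) (k : Hom a (d' ⊗ c'))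
              (lift : (w : Witness d ys) → Σ (Witness d' ys') λ v → (g *) (reindexed w) ≤ (k *) (reindexed v)) →
              ∀ ws → (g *) (joinW ws) ≤ (k *) (joinW (map (λ w → proj₁ (lift w)) ws))
  joinW-map g k lift [] = proj₁ (*-⊥ g) ⟫ Lat.⊥-min _
  joinW-map g k lift (w ∷ ws) =
    proj₁ (*-∨ g _ _) ⟫ ∨-mono (proj₂ (lift w)) (joinW-map g k lift ws) ⟫ proj₂ (*-∨ k _ _)

  covered-≤ : ∀ {c d} {ys : PE c} {x x' : P (d ⊗ c)} → x ≤ x' → Covered (d , x') ys → Covered (d , x) ys
  covered-≤ x≤ (ws , x'≤) = ws , (x≤ ⟫ x'≤)

  covered-⊥ : ∀ {c d} {ys : PE c} → Covered (d , ⊥) ys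
  covered-⊥ = [] , Lat.refl

  covered-∨ : ∀ {c d} {ys : PE c} {a b : P (d ⊗ c)} → Covered (d , a) ys → Covered (d , b) ys → Covered (d , (a ∨ b)) ys
  covered-∨ (ws , a≤) (vs , b≤) = (ws ++ vs) , (∨-mono a≤ b≤ ⟫ joinW-++ ws vs)

  covered-by : ∀ {c d} {ys : PE c} {x : P (d ⊗ c)} {ey : Gen c} → ey ∈ ys →
               (r : Hom (d ⊗ c) (proj₁ ey ⊗ c)) → p₂ ∘ r ≡ p₂ → x ≤ (r *) (proj₂ ey) → Covered (d , x) ys
  covered-by {ey = ey} m r r-over x≤ = ((ey , m , r , r-over) ∷ []) , (x≤ ⟫ Lat.∨-ub₁ _ _)

  ∈-covered : ∀ {c d} {ys : PE c} {x y : P (d ⊗ c)} → (d , y) ∈ ys → x ≤ y → Covered (d , x) ys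
  ∈-covered m x≤y = covered-by m id (identityʳ p₂) (x≤y ⟫ *-id≥)

  covered-bind : ∀ {c c' d d'} {ys : PE c} {ys' : PE c'} {x : P (d ⊗ c)} (g : Hom (d' ⊗ c') (d ⊗ c)) →
                 ((w : Witness d ys) → Covered (d' , (g *) (reindexed w)) ys') →
                 Covered (d , x) ys → Covered (d' , (g *) x) ys'
  covered-bind {d = d} {d'} {ys} {ys'} g cover (ws , x≤) = covered-≤ (*-mono g x≤) (join ws)
    where
    join : (ws : List (Witness d ys)) → Covered (d' , (g *) (joinW ws)) ys'
    join [] = covered-≤ (proj₁ (*-⊥ g)) covered-⊥
    join (w ∷ ws) = covered-≤ (proj₁ (*-∨ g _ _)) (covered-∨ (cover w) (join ws))

  covered-pull : ∀ {c d e} {zs : PE c} {y : P (e ⊗ c)} (r : Hom (d ⊗ c) (e ⊗ c)) → p₂ ∘ r ≡ p₂ →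
                 Covered (e , y) zs → Covered (d , (r *) y) zs
  covered-pull r r-over = covered-bind r λ where
    (_ , m , s , s-over) → covered-by m (s ∘ r) (over-∘ s-over r-over) (*-∘≥ s r)

  covered-trans : ∀ {c} {ys zs : PE c} {g : Gen c} → Covered g ys → All (λ h → Covered h zs) ys → Covered g zs
  covered-trans cv ys≤zs = covered-≤ *-id≥ (covered-bind id (λ where
    (_ , m , r , r-over) → covered-≤ *-id≤ (covered-pull r r-over (All.lookup ys≤zs m))) cv)

  covered-reindexE⁺ : ∀ {c c' d d'} {f : Hom c' c} {ys : PE c} {x : P (d ⊗ c)} (g : Hom (d' ⊗ c') (d ⊗ c)) →
                      p₂ ∘ g ≡ f ∘ p₂ → Covered (d , x) ys → Covered (d' , (g *) x) (reindexE f ys)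
  covered-reindexE⁺ {f = f} g g-over = covered-bind g λ where
    (_ , m , r , r-over) → covered-by (∈-map⁺ _ m) ⟨ p₁ ∘ (r ∘ g) , p₂ ⟩ (β₂ _ _)
      (*-∘≥ r g ⟫ *-cong (factor-over (r ∘ g) f (trans (sym (assoc _ _ _)) (trans (cong (_∘ g) r-over) g-over))) ⟫ *-∘≤ _ _)

  covered-reindexE⁻ : ∀ {c c' d d'} {f : Hom c' c} {ys : PE c} {a : P (d ⊗ c')} (k : Hom (d' ⊗ c) (d ⊗ c')) →
                      f ∘ (p₂ ∘ k) ≡ p₂ → Covered (d , a) (reindexE f ys) → Covered (d' , (k *) a) ys
  covered-reindexE⁻ {c} {c'} {d} {d'} {f} {ys} k k-over = covered-bind k witness
    where
    witness : (w : Witness d (reindexE f ys)) → Covered (d' , (k *) (reindexed w)) ys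
    witness (_ , m , s , s-over) with _ , m' , refl ← ∈-map⁻ _ m =
      covered-by m' ((id ×₁ f) ∘ (s ∘ k)) over (*-∘≥ s k ⟫ *-∘≥ _ _)
      where
      over : p₂ ∘ ((id ×₁ f) ∘ (s ∘ k)) ≡ p₂
      over = begin
        p₂ ∘ ((id ×₁ f) ∘ (s ∘ k))  ≡⟨ sym (assoc _ _ _) ⟩
        (p₂ ∘ (id ×₁ f)) ∘ (s ∘ k)  ≡⟨ cong (_∘ (s ∘ k)) (β₂ _ _) ⟩
        (f ∘ p₂) ∘ (s ∘ k)          ≡⟨ assoc _ _ _ ⟩
        f ∘ (p₂ ∘ (s ∘ k))          ≡⟨ cong (f ∘_) (trans (sym (assoc _ _ _)) (cong (_∘ k) s-over)) ⟩
        f ∘ (p₂ ∘ k)                ≡⟨ k-over ⟩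
        p₂                          ∎

  ⊤E : ∀ {c} → PE c
  ⊤E = (𝟙 , ⊤) ∷ []

  _⊓_ : ∀ {c} → Gen c → Gen c → Gen c
  (d , x) ⊓ (e , y) = (d ⊗ e) , (((p₁ ×₁ id) *) x ∧ ((p₂ ×₁ id) *) y)

  _⊓E_ : ∀ {c} → PE c → PE c → PE c
  _⊓E_ = cartesianProductWith _⊓_

  ∈-⊓E : ∀ {c} {xs ys : PE c} {g h : Gen c} → g ∈ xs → h ∈ ys → (g ⊓ h) ∈ (xs ⊓E ys)
  ∈-⊓E = ∈-cartesianProductWith⁺ _⊓_

  All-⊓E : ∀ {c q} {Q : Gen c → Set q} {xs ys : PE c} →
           (∀ {g h} → g ∈ xs → h ∈ ys → Q (g ⊓ h)) → All Q (xs ⊓E ys)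
  All-⊓E {Q = Q} {xs} {ys} Q⊓ = All.tabulate Q-member
    where
    Q-member : ∀ {k} → k ∈ xs ⊓E ys → Q k
    Q-member m with _ , _ , mg , mh , refl ← ∈-cartesianProductWith⁻ _⊓_ xs ys m = Q⊓ mg mh

  ⊆⇒≤E : ∀ {c} {xs ys : PE c} → xs ⊆ ys → xs ≤E ys
  ⊆⇒≤E xs⊆ys = All⇒≤E (All.tabulate λ m → ∈-covered (xs⊆ys m) Lat.refl)

  ≡⇒≤E : ∀ {c} {xs ys : PE c} → xs ≡ ys → xs ≤E ys
  ≡⇒≤E refl = ⊆⇒≤E λ m → m

  ≤E-trans : ∀ {c} {xs ys zs : PE c} → xs ≤E ys → ys ≤E zs → xs ≤E zs
  ≤E-trans xs≤ys ys≤zs = All⇒≤E (All.map (λ cv → covered-trans cv (≤E⇒All ys≤zs)) (≤E⇒All xs≤ys))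

  covered-∧ : ∀ {c f} {xs ys : PE c} (w : Witness f xs) (v : Witness f ys) →
              Covered (f , (reindexed w ∧ reindexed v)) (xs ⊓E ys)
  covered-∧ (_ , mx , r , r-over) (_ , my , s , s-over) =
    covered-by (∈-⊓E mx my) t (β₂ _ _)
      (∧-mono (*-cong (sym (fst r-over)) ⟫ *-∘≤ _ t) (*-cong (sym (snd s-over)) ⟫ *-∘≤ _ t) ⟫ *-∧≥ t)
    where
    t = ⟨ ⟨ p₁ ∘ r , p₁ ∘ s ⟩ , p₂ ⟩
    fst : p₂ ∘ r ≡ p₂ → (p₁ ×₁ id) ∘ t ≡ r
    fst over = trans (×₁∘⟨⟩ _ _ _ _) (trans (cong₂ ⟨_,_⟩ (β₁ _ _) (trans (identityˡ _) (sym over))) (⟨⟩-η r))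
    snd : p₂ ∘ s ≡ p₂ → (p₂ ×₁ id) ∘ t ≡ s
    snd over = trans (×₁∘⟨⟩ _ _ _ _) (trans (cong₂ ⟨_,_⟩ (β₂ _ _) (trans (identityˡ _) (sym over))) (⟨⟩-η s))

  covered-⊓E : ∀ {c} {xs ys : PE c} {g : Gen c} → Covered g xs → Covered g ys → Covered g (xs ⊓E ys)
  covered-⊓E {xs = xs} {ys} {f , _} (ws , x≤) (vs , y≤) = covered-≤ (Lat.∧-glb x≤ y≤) (joins ws)
    where
    witness-join : (w : Witness f xs) (vs : List (Witness f ys)) → Covered (f , (reindexed w ∧ joinW vs)) (xs ⊓E ys)
    witness-join w [] = covered-≤ (Lat.∧-lb₂ _ _) covered-⊥
    witness-join w (v ∷ vs) = covered-≤ (Lat.distrib _ _ _) (covered-∨ (covered-∧ w v) (witness-join w vs))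
    joins : (ws : List (Witness f xs)) → Covered (f , (joinW ws ∧ joinW vs)) (xs ⊓E ys)
    joins [] = covered-≤ (Lat.∧-lb₁ _ _) covered-⊥
    joins (w ∷ ws) = covered-≤ (distribʳ _ _ _) (covered-∨ (witness-join w vs) (joins ws))

  ⊓E-distrib-++ : ∀ {c} (xs ys zs : PE c) → xs ⊓E (ys ++ zs) ⊆ (xs ⊓E ys) ++ (xs ⊓E zs)
  ⊓E-distrib-++ xs ys zs m with _ , _ , mg , mh , refl ← ∈-cartesianProductWith⁻ _⊓_ xs (ys ++ zs) m
                              | ∈-++⁻ ys mh
  ... | inj₁ mh' = ∈-++⁺ˡ (∈-⊓E mg mh')
  ... | inj₂ mh' = ∈-++⁺ʳ (xs ⊓E ys) (∈-⊓E mg mh')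

  isDLatE : ∀ c → IsDLat (PE c) (_≤E_ {c})
  isDLatE c = record
    { refl = ⊆⇒≤E λ m → m
    ; trans = ≤E-trans
    ; ⊤ = ⊤E
    ; ⊥ = []
    ; _∧_ = _⊓E_
    ; _∨_ = _++_
    ; ⊤-max = λ xs → All⇒≤E (All.tabulate λ _ →
        covered-by (here refl) ⟨ ! , p₂ ⟩ (β₂ _ _) (Lat.⊤-max _ ⟫ proj₂ (*-⊤ _)))
    ; ⊥-min = λ xs → []
    ; ∧-lb₁ = λ xs ys → All⇒≤E (All-⊓E {xs = xs} {ys} λ m _ →
        covered-by m (p₁ ×₁ id) (trans (β₂ _ _) (identityˡ p₂)) (Lat.∧-lb₁ _ _))
    ; ∧-lb₂ = λ xs ys → All⇒≤E (All-⊓E {xs = xs} {ys} λ _ m →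
        covered-by m (p₂ ×₁ id) (trans (β₂ _ _) (identityˡ p₂)) (Lat.∧-lb₂ _ _))
    ; ∧-glb = λ xs≤ys xs≤zs → All⇒≤E (All.tabulate λ m →
        covered-⊓E (All.lookup (≤E⇒All xs≤ys) m) (All.lookup (≤E⇒All xs≤zs) m))
    ; ∨-ub₁ = λ xs ys → ⊆⇒≤E (xs⊆xs++ys xs ys)
    ; ∨-ub₂ = λ xs ys → ⊆⇒≤E (xs⊆ys++xs ys xs)
    ; ∨-lub = λ xs≤zs ys≤zs → All⇒≤E (All.++⁺ (≤E⇒All xs≤zs) (≤E⇒All ys≤zs))
    ; distrib = λ xs ys zs → ⊆⇒≤E (⊓E-distrib-++ xs ys zs)
    }

  ⊓-reindexE : ∀ {c c'} (f : Hom c' c) {xs ys : PE c} {g h : Gen c'} →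
               g ∈ reindexE f xs → h ∈ reindexE f ys → Covered (g ⊓ h) (reindexE f (xs ⊓E ys))
  ⊓-reindexE f mg mh with _ , mg' , refl ← ∈-map⁻ _ mg | _ , mh' , refl ← ∈-map⁻ _ mh =
    ∈-covered (∈-map⁺ _ (∈-⊓E mg' mh'))
      (∧-mono (*-square (sym (×₁-interchange _ _))) (*-square (sym (×₁-interchange _ _))) ⟫ *-∧≥ _)

  isDoctrineE : IsDoctrine C PreDoctrineE
  isDoctrineE = record
    { lat = isDLatE
    ; *-mono = λ f xs≤ys → All⇒≤E (All.map⁺ (All.map (covered-reindexE⁺ (id ×₁ f) (β₂ _ _)) (≤E⇒All xs≤ys)))
    ; *-⊤ = λ f → All⇒≤E (∈-covered (here refl) (Lat.⊤-max _) ∷ [])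
                , All⇒≤E (∈-covered (here refl) (proj₂ (*-⊤ _)) ∷ [])
    ; *-⊥ = λ f → [] , []
    ; *-∧ = λ f xs ys →
        All⇒≤E (All.map⁺ (All-⊓E {xs = xs} {ys} λ mg mh → ∈-covered (∈-⊓E (∈-map⁺ _ mg) (∈-map⁺ _ mh))
          (*-∧≤ _ ⟫ ∧-mono (*-square (×₁-interchange _ _)) (*-square (×₁-interchange _ _)))))
      , All⇒≤E (All-⊓E (⊓-reindexE f {xs} {ys}))
    ; *-∨ = λ f xs ys → ≡⇒≤E (map-++ _ xs ys) , ≡⇒≤E (sym (map-++ _ xs ys))
    ; *-id = λ xs →
        All⇒≤E (All.map⁺ (All.tabulate λ m → ∈-covered m (*-cong id×₁id ⟫ *-id≤)))
      , All⇒≤E (All.tabulate λ m → ∈-covered (∈-map⁺ _ m) (*-id≥ ⟫ *-cong (sym id×₁id)))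
    ; *-∘ = λ g f xs →
        All⇒≤E (All.map⁺ (All.tabulate λ m → ∈-covered (∈-map⁺ _ (∈-map⁺ _ m)) (*-cong (id×₁∘ g f) ⟫ *-∘≤ _ _)))
      , All⇒≤E (All.map⁺ (All.map⁺ (All.tabulate λ m → ∈-covered (∈-map⁺ _ m) (*-∘≥ _ _ ⟫ *-cong (sym (id×₁∘ g f))))))
    }

  ΣE-transpose : ∀ {d c e} {a : P (e ⊗ (d ⊗ c))} {ys : PE c} →
                 Covered (e ⊗ d , (α *) a) ys → Covered (e , a) (reindexE p₂ ys)
  ΣE-transpose cv = covered-≤ (*-section≥ α∘α⁻¹) (covered-reindexE⁺ α⁻¹ (β₂ _ _) cv)

  ΣE-untranspose : ∀ {d c e} {a : P (e ⊗ (d ⊗ c))} {ys : PE c} →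
                   Covered (e , a) (reindexE p₂ ys) → Covered (e ⊗ d , (α *) a) ys
  ΣE-untranspose = covered-reindexE⁻ α (trans (cong (p₂ ∘_) (β₂ _ _)) (β₂ _ _))

  frobenius-≤ : ∀ {d c} {xs : PE c} {ys : PE (d ⊗ c)} {g h : Gen c} → g ∈ xs → h ∈ ΣE d c ys →
                Covered (g ⊓ h) (ΣE d c (reindexE p₂ xs ⊓E ys))
  frobenius-≤ mg mh with _ , mh' , refl ← ∈-map⁻ _ mh =
    covered-by (∈-map⁺ _ (∈-⊓E (∈-map⁺ _ mg) mh')) regroup (β₂ _ _)
      (∧-mono (*-cong regroup-fst ⟫ *-∘₃≤) (*-square regroup-snd) ⟫ *-∧≥ _ ⟫ *-∘≤ α regroup)

  frobenius-≥ : ∀ {d c} {xs : PE c} {ys : PE (d ⊗ c)} {g h : Gen (d ⊗ c)} → g ∈ reindexE p₂ xs → h ∈ ys →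
                Covered ((proj₁ (g ⊓ h) ⊗ d) , (α *) (proj₂ (g ⊓ h))) (xs ⊓E ΣE d c ys)
  frobenius-≥ mg mh with _ , mg' , refl ← ∈-map⁻ _ mg =
    covered-by (∈-⊓E mg' (∈-map⁺ _ mh)) regroup⁻¹ (β₂ _ _)
      (*-∧≤ α ⟫ ∧-mono (*-∘₃≥ ⟫ *-cong regroup⁻¹-fst ⟫ *-∘≤ _ _) (*-∘≥ _ _ ⟫ *-cong regroup⁻¹-snd ⟫ *-∘₃≤)
              ⟫ *-∧≥ regroup⁻¹)

  hasExistsE : HasExists C PreDoctrineE isDoctrineE ΣE
  hasExistsE = record
    { ∃-adj = λ d c xs ys → mk⇔
        (λ Σxs≤ys → All⇒≤E (All.map ΣE-transpose (All.map⁻ (≤E⇒All Σxs≤ys))))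
        (λ xs≤ys → All⇒≤E (All.map⁺ (All.map ΣE-untranspose (≤E⇒All xs≤ys))))
    ; frobenius = λ d c xs ys →
        All⇒≤E (All-⊓E {xs = xs} (frobenius-≤ {ys = ys}))
      , All⇒≤E (All.map⁺ (All-⊓E {ys = ys} (frobenius-≥ {xs = xs})))
    ; beck-chevalley = λ d f xs →
        All⇒≤E (All.map⁺ (All.map⁺ (All.tabulate λ m → ∈-covered (∈-map⁺ _ (∈-map⁺ _ m)) (*-square (α-natural f)))))
      , All⇒≤E (All.map⁺ (All.map⁺ (All.tabulate λ m → ∈-covered (∈-map⁺ _ (∈-map⁺ _ m)) (*-square (sym (α-natural f))))))
    }

  module Equality (δ : ∀ d → P (d ⊗ d)) (hasEq : HasEq C D isD δ) where
    open HasEq hasEq using (eq-adj)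
    open Equivalence using (to; from)

    -- weakened a ⊓ δ-weakened is the generator of π_d* {(e , a)} ∧ π_d'* δE.
    weakened : ∀ {d' d e} → P (e ⊗ (d' ⊗ d)) → Gen (d' ⊗ (d ⊗ d))
    weakened {e = e} a = e , ((id ×₁ (id ×₁ p₁)) *) a

    δ-weakened : ∀ {d' d} → Gen (d' ⊗ (d ⊗ d))
    δ-weakened {d = d} = 𝟙 , ((id ×₁ p₂) *) ((p₂ *) (δ d))

    α*-δ-meet : ∀ {d' d e} (a : P (e ⊗ (d' ⊗ d))) →
                (α *) (proj₂ (weakened a ⊓ δ-weakened)) ≈ (((id ×₁ p₁) *) ((unpack *) a) ∧ (p₂ *) (δ d))
    α*-δ-meet a =
        *-∧≤ α ⟫ ∧-mono (*-∘₃≥ ⟫ *-cong (sym unpack∘id×₁p₁) ⟫ *-∘≤ _ _)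
                        (*-mono α *-∘₃≥ ⟫ *-∘≥ _ α ⟫ *-cong (sym p₂≡p₂∘id×₁p₂∘p₂×₁id∘α))
      , ∧-mono (*-∘≥ _ _ ⟫ *-cong unpack∘id×₁p₁ ⟫ *-∘₃≤)
               (*-cong p₂≡p₂∘id×₁p₂∘p₂×₁id∘α ⟫ *-∘≤ _ α ⟫ *-mono α *-∘₃≤) ⟫ *-∧≥ α

    δ-transpose : ∀ {d' d e} {a : P (e ⊗ (d' ⊗ d))} {ys : PE (d' ⊗ (d ⊗ d))} →
                  Covered (weakened a ⊓ δ-weakened) ys → Covered (e , a) (reindexE (id ×₁ Δ) ys)
    δ-transpose {d'} {d} {e} {a} cv = covered-≤ a≤ (covered-reindexE⁺ pack-diag p₂∘pack-diag cv)
      where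
      unit : (unpack *) a ≤ ((id ×₁ Δ) *) ((α *) (proj₂ (weakened a ⊓ δ-weakened)))
      unit = to (eq-adj ((e ⊗ 𝟙) ⊗ d') d _ _) (proj₂ (α*-δ-meet a))
      a≤ : a ≤ (pack-diag *) (proj₂ (weakened a ⊓ δ-weakened))
      a≤ = *-section≥ unpack∘pack ⟫ *-mono pack (unit ⟫ *-∘≥ α (id ×₁ Δ)) ⟫ *-∘≥ _ pack ⟫ *-cong (assoc _ _ _)

    lift-witness : ∀ {d' d e} {ys : PE (d' ⊗ (d ⊗ d))} (w : Witness e (reindexE (id ×₁ Δ) ys)) →
                   Σ (Witness (e ⊗ 𝟙) ys) λ v → (unpack *) (reindexed w) ≤ ((α ∘ (id ×₁ Δ)) *) (reindexed v)
    lift-witness (_ , m , t , t-over) with _ , m' , refl ← ∈-map⁻ _ m =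
        (_ , m' , ⟨ p₁ ∘ (t ∘ contract) , p₂ ⟩ , β₂ _ _)
      , (*-mono unpack (*-∘≥ _ t) ⟫ *-∘≥ _ unpack ⟫ *-cong (diagonal-lift t t-over) ⟫ *-∘≤ _ _)

    δ-untranspose : ∀ {d' d e} {a : P (e ⊗ (d' ⊗ d))} {ys : PE (d' ⊗ (d ⊗ d))} →
                    Covered (e , a) (reindexE (id ×₁ Δ) ys) → Covered (weakened a ⊓ δ-weakened) ys
    δ-untranspose {d'} {d} {e} {a} {ys} (ws , a≤) = vs , generator≤vs
      where
      vs : List (Witness (e ⊗ 𝟙) ys)
      vs = map (λ w → proj₁ (lift-witness w)) ws
      premise : (unpack *) a ≤ ((id ×₁ Δ) *) ((α *) (joinW vs))
      premise = *-mono unpack a≤ ⟫ joinW-map unpack (α ∘ (id ×₁ Δ)) lift-witness ws ⟫ *-∘≤ α (id ×₁ Δ)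
      generator≤vs : proj₂ (weakened a ⊓ δ-weakened) ≤ joinW vs
      generator≤vs = *-section≥ α∘α⁻¹
          ⟫ *-mono α⁻¹ (proj₁ (α*-δ-meet a) ⟫ from (eq-adj ((e ⊗ 𝟙) ⊗ d') d _ _) premise)
          ⟫ *-section≤ α∘α⁻¹

    δ-untranspose-∈ : ∀ {d' d} {xs : PE (d' ⊗ d)} {ys : PE (d' ⊗ (d ⊗ d))} {g h : Gen (d' ⊗ (d ⊗ d))} →
                      xs ≤E reindexE (id ×₁ Δ) ys → g ∈ reindexE (id ×₁ p₁) xs → h ∈ reindexE p₂ (δE δ d) →
                      Covered (g ⊓ h) ys
    δ-untranspose-∈ xs≤ mg (here refl) with _ , mg' , refl ← ∈-map⁻ _ mg = δ-untranspose (All.lookup (≤E⇒All xs≤) mg')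

    hasEqE : HasEq C PreDoctrineE isDoctrineE (δE δ)
    hasEqE = record
      { eq-adj = λ d' d xs ys → mk⇔
          (λ δ-meet≤ys → All⇒≤E (All.tabulate λ m →
            δ-transpose (All.lookup (≤E⇒All δ-meet≤ys) (∈-⊓E (∈-map⁺ _ m) (here refl)))))
          (λ xs≤ys → All⇒≤E (All-⊓E (δ-untranspose-∈ xs≤ys)))
      }

proposition4p11 : ∀ {o h p l} (C : Cat o h) (D : PreDoctrine C p l) (isD : IsDoctrine C D)
    (δ : ∀ d → PreDoctrine.P D (Cat._⊗_ C d d)) → HasEq C D isD δ →
    Σ (IsDoctrine C (Completion.PreDoctrineE C D isD)) λ isE →
      HasExists C (Completion.PreDoctrineE C D isD) isE (Completion.ΣE C D isD)
      × HasEq C (Completion.PreDoctrineE C D isD) isE (Completion.δE C D isD δ)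
proposition4p11 C D isD δ hasEq = isDoctrineE , hasExistsE , Equality.hasEqE δ hasEq
  where open ExistentialCompletion C D isD
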